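{- For every integer $s\ge 2$, the maximum length (number of edges) of a path graph that is isomorphic to $\mathcal{G}(w)$ for some nonempty word $w$ over $\Sigma_s$ is $3s-3$.
   Context: $\Sigma_s$ denotes the ordered alphabet $\{a_1<a_2<\dots<a_s\}$. For a nonempty word $w=w_1\cdots w_n$ over $\Sigma_s$, the Parikh graph $\mathcal{G}(w)$ is the simple undirected graph on $\{1,\dots,n\}$ where, for $i<j$, $i$ and $j$ are adjacent iff $w_i=a_k$ and $w_j=a_{k+1}$ for some $1\le k\le s-1$. A path graph of length $m$ is a path on $m+1$ vertices (with $m$ edges). -}

module Defs where

open import Data.Nat using (ℕ; suc)
open import Data.Fin using (Fin; toℕ; _<_)
open import Data.Product using (_×_; Σ)
open import Data.Sum using (_⊎_)
open import Function.Bundles using (_↔_; Inverse)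
open import Relation.Binary.PropositionalEquality using (_≡_)
open import Level using (0ℓ)
open import Relation.Binary.Core using (Rel)

-- A word of length n over Σ_s = {a_1 < ... < a_s}; letter a_{k+1} is encoded as (k : Fin s).
Word : ℕ → ℕ → Set
Word s n = Fin n → Fin s

ParikhArc : ∀ {s n} → Word s n → Fin n → Fin n → Set
ParikhArc w i j = (i < j) × (toℕ (w j) ≡ suc (toℕ (w i)))

ParikhAdj : ∀ {s n} → Word s n → Rel (Fin n) 0ℓ
ParikhAdj w i j = ParikhArc w i j ⊎ ParikhArc w j i

PathAdj : (m : ℕ) → Rel (Fin (suc m)) 0ℓ
PathAdj m i j = (toℕ j ≡ suc (toℕ i)) ⊎ (toℕ i ≡ suc (toℕ j))

record GraphIso {n k : ℕ} (R : Rel (Fin n) 0ℓ) (S : Rel (Fin k) 0ℓ) : Set where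
  field
    bij      : Fin n ↔ Fin k
    preserve : ∀ i j → R i j → S (Inverse.to bij i) (Inverse.to bij j)
    reflect  : ∀ i j → S (Inverse.to bij i) (Inverse.to bij j) → R i j

ParikhIsPath : ∀ {s n} → Word s n → ℕ → Set
ParikhIsPath {s} {n} w m = GraphIso (ParikhAdj w) (PathAdj m)

module Submission where

-- Write s = N + 1, so that the arcs a_ℓ → a_{ℓ+1} of a Parikh graph carry one
-- of N labels ℓ < N.
--
-- Suppose G(w) ≅ P_m.  Each path edge {t, t+1} is realised by an
-- arc p → q of G(w); label it by the letter of p.  If two path edges t < t' have
-- the same label, their sources have a common neighbour in G(w) and so do their
-- targets, so along the path both endpoints move by at most 2 and t' ≤ t + 2.
-- Hence t ↦ (label t, t mod 3) is injective and m ≤ 3N by pigeonhole.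
--
-- For the word (read left to right, letters indexed from 0)
--   A = N-1, N-2, …, 0    B = N, N-1, …, 0    C = N, N-1, …, 1
-- the arcs of G(ABC) are exactly A_i — B_i, A_i — C_i and B_{i+1} — C_i, so
-- G(ABC) is the path B_0 A_0 C_0 B_1 A_1 C_1 … B_N of length 3N.

open import Defs
open import Data.Nat using (ℕ; zero; suc; _+_; _*_; _∸_; _≤_; _<_; s≤s; z≤n; s≤s⁻¹; _≤?_; _<?_)
open import Data.Nat.Properties
open import Data.Nat.Tactic.RingSolver using (solve-∀)
open import Data.Fin using (Fin; toℕ; fromℕ<; inject₁; combine)
open import Data.Fin.Properties using (toℕ-fromℕ<; toℕ<n; toℕ-inject₁; toℕ-injective; pigeonhole; combine-injective)
open import Data.Product using (_×_; Σ; _,_; proj₁; proj₂)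
open import Data.Sum using (_⊎_; inj₁; inj₂)
import Data.Sum as Sum
open import Data.Empty using (⊥-elim)
open import Relation.Nullary using (yes; no)
open import Relation.Binary.PropositionalEquality
open import Function.Bundles using (_↔_; Inverse; mk↔ₛ′)

Adjacent : ℕ → ℕ → Set
Adjacent a b = b ≡ suc a ⊎ a ≡ suc b

common-neighbour⇒close : ∀ {a b c} → Adjacent a c → Adjacent b c → b ≤ 2 + a
common-neighbour⇒close {a} (inj₁ refl) (inj₁ refl) = m≤n+m a 2
common-neighbour⇒close     (inj₁ refl) (inj₂ refl) = ≤-refl
common-neighbour⇒close {b = b} (inj₂ refl) (inj₁ refl) = m≤n+m b 4
common-neighbour⇒close {b = b} (inj₂ refl) (inj₂ refl) = m≤n+m b 2

sum-of-consecutive-reflects-≤ : ∀ a b → b + suc b ≤ a + suc a → b ≤ a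
sum-of-consecutive-reflects-≤ a b le with b ≤? a
... | yes b≤a = b≤a
... | no b≰a = ⊥-elim (<⇒≱ (+-mono-< a<b (s≤s a<b)) le)
  where
  a<b : a < b
  a<b = ≰⇒> b≰a

-- Moving both ends of the path edge {t, t+1} two steps forward.
shift-sum-of-consecutive : ∀ a b t → a + b ≡ t + suc t → (2 + a) + (2 + b) ≡ (2 + t) + suc (2 + t)
shift-sum-of-consecutive a b t e = begin
  (2 + a) + (2 + b)       ≡⟨ regroup a b ⟩
  4 + (a + b)             ≡⟨ cong (4 +_) e ⟩
  4 + (t + suc t)         ≡⟨ regroup′ t ⟩
  (2 + t) + suc (2 + t)   ∎
  where
  open ≡-Reasoning
  regroup : ∀ a b → (2 + a) + (2 + b) ≡ 4 + (a + b)
  regroup = solve-∀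
  regroup′ : ∀ t → 4 + (t + suc t) ≡ (2 + t) + suc (2 + t)
  regroup′ = solve-∀

-- The residue of t modulo 3, by recursion so that residue (3 + t) = residue t.
residue : ℕ → Fin 3
residue 0 = Fin.zero
residue 1 = Fin.suc Fin.zero
residue 2 = Fin.suc (Fin.suc Fin.zero)
residue (suc (suc (suc t))) = residue t

residue-gap : ∀ i d → d ≤ 1 → residue i ≢ residue (suc i + d)
residue-gap 0 0 _ ()
residue-gap 0 1 _ ()
residue-gap 1 0 _ ()
residue-gap 1 1 _ ()
residue-gap 2 0 _ ()
residue-gap 2 1 _ ()
residue-gap (suc (suc (suc i))) d d≤1 = residue-gap i d d≤1
residue-gap _ (suc (suc _)) (s≤s ())

-- Pigeonhole with a window: if m positions are labelled by N labels so that
-- equal labels are never 3 or more apart, each label is used at most three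
-- times and m ≤ 3N.  (The pair (label, residue mod 3) is injective.)
windowed-labelling-bound : ∀ {m N} (label : Fin m → Fin N) →
  (∀ i j → label i ≡ label j → toℕ j ≤ 2 + toℕ i) → m ≤ N * 3
windowed-labelling-bound {m} {N} label window with m ≤? N * 3
... | yes m≤3N = m≤3N
... | no m≰3N
  with i , j , i<j , collision ← pigeonhole (≰⇒> m≰3N) (λ t → combine (label t) (residue (toℕ t)))
  with same-label , same-residue ← combine-injective (label i) _ (label j) _ collision
  with d , i+1+d≡j ← m≤n⇒∃[o]m+o≡n i<j
  = ⊥-elim (residue-gap (toℕ i) d d≤1 (trans same-residue (cong residue (sym i+1+d≡j))))
  where
  d≤1 : d ≤ 1
  d≤1 = +-cancelˡ-≤ (suc (toℕ i)) d 1
          (subst₂ _≤_ (sym i+1+d≡j) (+-comm 1 (suc (toℕ i))) (window i j same-label))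

CommonNeighbour : ∀ {s n} → Word s n → Fin n → Fin n → Set
CommonNeighbour {n = n} w p q = Σ (Fin n) λ c → ParikhAdj w p c × ParikhAdj w q c

module SameLetterArcs {s n} (w : Word s n) {p₁ q₁ p₂ q₂ : Fin n}
  (arc₁ : ParikhArc w p₁ q₁) (arc₂ : ParikhArc w p₂ q₂) (same : toℕ (w p₁) ≡ toℕ (w p₂)) where

  p₁<q₁ : toℕ p₁ < toℕ q₁
  p₁<q₁ = proj₁ arc₁
  p₂<q₂ : toℕ p₂ < toℕ q₂
  p₂<q₂ = proj₁ arc₂
  q₁-after-p₂ : toℕ (w q₁) ≡ suc (toℕ (w p₂))
  q₁-after-p₂ = trans (proj₂ arc₁) (cong suc same)
  q₂-after-p₁ : toℕ (w q₂) ≡ suc (toℕ (w p₁))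
  q₂-after-p₁ = trans (proj₂ arc₂) (cong suc (sym same))

  sources-neighbour : CommonNeighbour w p₁ p₂
  sources-neighbour with toℕ q₂ ≤? toℕ q₁
  ... | yes q₂≤q₁ = q₁ , inj₁ arc₁ , inj₁ (<-≤-trans p₂<q₂ q₂≤q₁ , q₁-after-p₂)
  ... | no q₂≰q₁ = q₂ , inj₁ (<-trans p₁<q₁ (≰⇒> q₂≰q₁) , q₂-after-p₁) , inj₁ arc₂

  targets-neighbour : CommonNeighbour w q₁ q₂
  targets-neighbour with toℕ p₁ ≤? toℕ p₂
  ... | yes p₁≤p₂ = p₁ , inj₂ arc₁ , inj₂ (≤-<-trans p₁≤p₂ p₂<q₂ , q₂-after-p₁)
  ... | no p₁≰p₂ = p₂ , inj₂ (<-trans (≰⇒> p₁≰p₂) p₁<q₁ , q₁-after-p₂) , inj₂ arc₂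

module UpperBound {N n m} (w : Word (suc N) (suc n)) (iso : ParikhIsPath w m) where
  open GraphIso iso
  open Inverse bij using (to; from; strictlyInverseˡ)

  place : Fin (suc n) → ℕ
  place p = toℕ (to p)

  place-from : ∀ v → place (from v) ≡ toℕ v
  place-from v = cong toℕ (strictlyInverseˡ v)

  close : ∀ {p q} → CommonNeighbour w p q → place q ≤ 2 + place p
  close (_ , p~c , q~c) = common-neighbour⇒close (preserve _ _ p~c) (preserve _ _ q~c)

  -- An arc of G(w) realising the path edge {t, t+1}.
  record EdgeArc (t : ℕ) : Set where
    field
      source target : Fin (suc n)
      arc : ParikhArc w source target
      endpoints : place source + place target ≡ t + suc t

  lower upper : Fin m → Fin (suc n)
  lower t = from (inject₁ t)
  upper t = from (Fin.suc t)

  place-lower : ∀ t → place (lower t) ≡ toℕ t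
  place-lower t = trans (place-from (inject₁ t)) (toℕ-inject₁ t)

  place-upper : ∀ t → place (upper t) ≡ suc (toℕ t)
  place-upper t = place-from (Fin.suc t)

  edgeArc : (t : Fin m) → EdgeArc (toℕ t)
  edgeArc t with reflect (lower t) (upper t) (inj₁ (trans (place-upper t) (cong suc (sym (place-lower t)))))
  ... | inj₁ lower→upper = record
    { arc = lower→upper ; endpoints = cong₂ _+_ (place-lower t) (place-upper t) }
  ... | inj₂ upper→lower = record
    { arc = upper→lower
    ; endpoints = trans (+-comm (place (upper t)) _) (cong₂ _+_ (place-lower t) (place-upper t)) }

  -- The label of a path edge: the letter at the source of its arc.
  label : Fin m → Fin N
  label t = fromℕ< (s≤s⁻¹ (subst (_< suc N) (proj₂ arc) (toℕ<n (w target))))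
    where open EdgeArc (edgeArc t)

  toℕ-label : ∀ t → toℕ (label t) ≡ toℕ (w (EdgeArc.source (edgeArc t)))
  toℕ-label t = toℕ-fromℕ< _

  window : ∀ i j → label i ≡ label j → toℕ j ≤ 2 + toℕ i
  window i j same = sum-of-consecutive-reflects-≤ (2 + toℕ i) (toℕ j) (begin
      toℕ j + suc (toℕ j)                                 ≡⟨ sym (endpoints eⱼ) ⟩
      place (source eⱼ) + place (target eⱼ)               ≤⟨ +-mono-≤ (close sources-neighbour) (close targets-neighbour) ⟩
      (2 + place (source eᵢ)) + (2 + place (target eᵢ))   ≡⟨ shift-sum-of-consecutive _ _ _ (endpoints eᵢ) ⟩
      (2 + toℕ i) + suc (2 + toℕ i)                       ∎)
    where
    open ≤-Reasoning
    open EdgeArc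
    eᵢ : EdgeArc (toℕ i)
    eᵢ = edgeArc i
    eⱼ : EdgeArc (toℕ j)
    eⱼ = edgeArc j
    same-letter : toℕ (w (source eᵢ)) ≡ toℕ (w (source eⱼ))
    same-letter = trans (sym (toℕ-label i)) (trans (cong toℕ same) (toℕ-label j))
    open SameLetterArcs w (arc eᵢ) (arc eⱼ) same-letter

  bound : m ≤ N * 3
  bound = windowed-labelling-bound label window

iso-from-arcs : ∀ {s n T} (w : Word s n) (φ : Fin n ↔ Fin (suc T)) →
  (∀ i j → ParikhArc w i j → PathAdj T (Inverse.to φ i) (Inverse.to φ j)) →
  (∀ i j → toℕ (Inverse.to φ j) ≡ suc (toℕ (Inverse.to φ i)) → ParikhAdj w i j) →
  ParikhIsPath w T
iso-from-arcs w φ arc⇒edge successor⇒arc = record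
  { bij = φ
  ; preserve = λ where
      i j (inj₁ i→j) → arc⇒edge i j i→j
      i j (inj₂ j→i) → Sum.swap (arc⇒edge j i j→i)
  ; reflect = λ where
      i j (inj₁ j-next) → successor⇒arc i j j-next
      i j (inj₂ i-next) → Sum.swap (successor⇒arc j i i-next)
  }

module Restrict {T : ℕ} (f g : ℕ → ℕ)
  (f≤ : ∀ {x} → x ≤ T → f x ≤ T) (g≤ : ∀ {x} → x ≤ T → g x ≤ T)
  (f∘g : ∀ {x} → x ≤ T → f (g x) ≡ x) (g∘f : ∀ {x} → x ≤ T → g (f x) ≡ x) where

  bounded : (i : Fin (suc T)) → toℕ i ≤ T
  bounded i = s≤s⁻¹ (toℕ<n i)

  restrict : (h : ℕ → ℕ) → (∀ {x} → x ≤ T → h x ≤ T) → Fin (suc T) → Fin (suc T)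
  restrict h h≤ i = fromℕ< (s≤s (h≤ (bounded i)))

  permutation : Fin (suc T) ↔ Fin (suc T)
  permutation = mk↔ₛ′ (restrict f f≤) (restrict g g≤) (inverse f≤ g≤ f∘g) (inverse g≤ f≤ g∘f)
    where
    inverse : ∀ {h k : ℕ → ℕ} (h≤ : ∀ {x} → x ≤ T → h x ≤ T) (k≤ : ∀ {x} → x ≤ T → k x ≤ T) →
              (∀ {x} → x ≤ T → h (k x) ≡ x) → ∀ i → restrict h h≤ (restrict k k≤ i) ≡ i
    inverse {h} {k} h≤ k≤ h∘k i = toℕ-injective (begin
      toℕ (restrict h h≤ (restrict k k≤ i)) ≡⟨ toℕ-fromℕ< _ ⟩
      h (toℕ (restrict k k≤ i))             ≡⟨ cong h (toℕ-fromℕ< _) ⟩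
      h (k (toℕ i))                         ≡⟨ h∘k (bounded i) ⟩
      toℕ i                                 ∎)
      where open ≡-Reasoning

  toℕ-permutation : ∀ i → toℕ (Inverse.to permutation i) ≡ f (toℕ i)
  toℕ-permutation i = toℕ-fromℕ< _

-- The three blocks A, B, C of the extremal word; a code (X , i) is the i-th
-- letter of block X.
data Block : Set where
  A B C : Block

Code : Set
Code = Block × ℕ

vertex : Code → ℕ
vertex (B , i) = i * 3
vertex (A , i) = suc (i * 3)
vertex (C , i) = suc (suc (i * 3))

next : Code → Code
next (B , i) = A , i
next (A , i) = C , i
next (C , i) = B , suc i

vertex-next : ∀ c → vertex (next c) ≡ suc (vertex c)
vertex-next (B , i) = refl
vertex-next (A , i) = refl
vertex-next (C , i) = refl

vertexCode : ℕ → Code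
vertexCode zero = B , 0
vertexCode (suc v) = next (vertexCode v)

vertex-vertexCode : ∀ v → vertex (vertexCode v) ≡ v
vertex-vertexCode zero = refl
vertex-vertexCode (suc v) = trans (vertex-next (vertexCode v)) (cong suc (vertex-vertexCode v))

vertexCode-B : ∀ i → vertexCode (i * 3) ≡ (B , i)
vertexCode-B zero = refl
vertexCode-B (suc i) = cong (λ c → next (next (next c))) (vertexCode-B i)

vertexCode-vertex : ∀ c → vertexCode (vertex c) ≡ c
vertexCode-vertex (B , i) = vertexCode-B i
vertexCode-vertex (A , i) = cong next (vertexCode-B i)
vertexCode-vertex (C , i) = cong (λ c → next (next c)) (vertexCode-B i)

vertex-injective : ∀ {c d} → vertex c ≡ vertex d → c ≡ d
vertex-injective {c} {d} e = begin
  c                    ≡⟨ sym (vertexCode-vertex c) ⟩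
  vertexCode (vertex c) ≡⟨ cong vertexCode e ⟩
  vertexCode (vertex d) ≡⟨ vertexCode-vertex d ⟩
  d                    ∎
  where open ≡-Reasoning

≤⇒≢suc : ∀ {x y} → x ≤ y → x ≢ suc y
≤⇒≢suc x≤y x≡1+y = ≤⇒≯ x≤y (≤-reflexive (sym x≡1+y))

triple : ∀ N → N * 3 ≡ N + N + N
triple = solve-∀

module ExtremalWord (N : ℕ) where

  Valid : Code → Set
  Valid (A , i) = i < N
  Valid (B , i) = i ≤ N
  Valid (C , i) = i < N

  position : Code → ℕ
  position (A , i) = i
  position (B , i) = N + i
  position (C , i) = suc (N + N + i)

  letter : Code → ℕ
  letter (A , i) = N ∸ suc i
  letter (B , i) = N ∸ i
  letter (C , i) = N ∸ i

  CodeArc : Code → Code → Set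
  CodeArc c d = position c < position d × letter d ≡ suc (letter c)

  letter-bound : ∀ c → letter c ≤ N
  letter-bound (A , i) = m∸n≤m N (suc i)
  letter-bound (B , i) = m∸n≤m N i
  letter-bound (C , i) = m∸n≤m N i

  letter-step : ∀ {i} → i < N → N ∸ i ≡ suc (N ∸ suc i)
  letter-step i<N = +-∸-assoc 1 i<N

  -- Other pairs fail either
  -- because letters decrease within a block or because of the block order.
  arc⇒consecutive : ∀ c d → Valid c → Valid d → CodeArc c d → d ≡ next c ⊎ c ≡ next d
  arc⇒consecutive (A , i) (A , k) _ _ (i<k , e) = ⊥-elim (≤⇒≢suc (∸-monoʳ-≤ N (s≤s (<⇒≤ i<k))) e)
  arc⇒consecutive (A , i) (B , k) i<N k≤N (_ , e)
    with refl ← ∸-cancelˡ-≡ k≤N (<⇒≤ i<N) (trans e (sym (letter-step i<N))) = inj₂ refl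
  arc⇒consecutive (A , i) (C , k) i<N k<N (_ , e)
    with refl ← ∸-cancelˡ-≡ (<⇒≤ k<N) (<⇒≤ i<N) (trans e (sym (letter-step i<N))) = inj₁ refl
  arc⇒consecutive (B , i) (A , k) _ k<N (p , _) = ⊥-elim (<-asym (<-≤-trans k<N (m≤m+n N i)) p)
  arc⇒consecutive (B , i) (B , k) _ _ (p , e) = ⊥-elim (≤⇒≢suc (∸-monoʳ-≤ N (<⇒≤ (+-cancelˡ-< N i k p))) e)
  arc⇒consecutive (B , i) (C , k) i≤N k<N (_ , e)
    with refl ← ∸-cancelˡ-≡ k<N i≤N (suc-injective (trans (sym (letter-step k<N)) e)) = inj₂ refl
  arc⇒consecutive (C , i) (A , k) _ k<N (p , _) =
    ⊥-elim (<-asym (<-≤-trans k<N (≤-trans (m≤m+n N N) (≤-trans (m≤m+n (N + N) i) (n≤1+n _)))) p)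
  arc⇒consecutive (C , i) (B , k) _ k≤N (p , _) =
    ⊥-elim (<⇒≱ p (≤-trans (+-monoʳ-≤ N k≤N) (≤-trans (m≤m+n (N + N) i) (n≤1+n _))))
  arc⇒consecutive (C , i) (C , k) _ _ (p , e) =
    ⊥-elim (≤⇒≢suc (∸-monoʳ-≤ N (<⇒≤ (+-cancelˡ-< (N + N) i k (s≤s⁻¹ p)))) e)

  consecutive⇒arc : ∀ c → Valid c → Valid (next c) → CodeArc c (next c) ⊎ CodeArc (next c) c
  consecutive⇒arc (B , i) _ i<N = inj₂ (<-≤-trans i<N (m≤m+n N i) , letter-step i<N)
  consecutive⇒arc (A , i) i<N _ = inj₁ (s≤s (m≤n+m i (N + N)) , letter-step i<N)
  consecutive⇒arc (C , i) i<N _ =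
    inj₂ (s≤s (≤-trans (+-monoʳ-≤ N i<N) (m≤m+n (N + N) i)) , letter-step i<N)

  vertex-bound : ∀ c → Valid c → vertex c ≤ N * 3
  vertex-bound (B , i) i≤N = *-monoˡ-≤ 3 i≤N
  vertex-bound (A , i) i<N = ≤-trans (m≤n+m _ 2) (*-monoˡ-≤ 3 i<N)
  vertex-bound (C , i) i<N = ≤-trans (m≤n+m _ 1) (*-monoˡ-≤ 3 i<N)

  valid-next : ∀ c → Valid c → vertex c < N * 3 → Valid (next c)
  valid-next (B , i) _ i*3<N*3 = *-cancelʳ-< 3 i N i*3<N*3
  valid-next (A , i) i<N _ = i<N
  valid-next (C , i) i<N _ = i<N

  valid-vertexCode : ∀ v → v ≤ N * 3 → Valid (vertexCode v)
  valid-vertexCode zero _ = z≤n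
  valid-vertexCode (suc v) v<N*3 = valid-next (vertexCode v) (valid-vertexCode v (<⇒≤ v<N*3))
    (subst (_< N * 3) (sym (vertex-vertexCode v)) v<N*3)

  positionCode : ℕ → Code
  positionCode p with p <? N
  ... | yes _ = A , p
  ... | no _ with p ≤? N + N
  ...   | yes _ = B , p ∸ N
  ...   | no _ = C , p ∸ suc (N + N)

  position-positionCode : ∀ p → position (positionCode p) ≡ p
  position-positionCode p with p <? N
  ... | yes _ = refl
  ... | no p≮N with p ≤? N + N
  ...   | yes _ = m+[n∸m]≡n (≮⇒≥ p≮N)
  ...   | no p≰2N = m+[n∸m]≡n (≰⇒> p≰2N)

  positionCode-position : ∀ c → Valid c → positionCode (position c) ≡ c
  positionCode-position (A , i) i<N with i <? N
  ... | yes _ = refl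
  ... | no i≮N = ⊥-elim (i≮N i<N)
  positionCode-position (B , i) i≤N with N + i <? N
  ... | yes N+i<N = ⊥-elim (<⇒≱ N+i<N (m≤m+n N i))
  ... | no _ with N + i ≤? N + N
  ...   | yes _ = cong (B ,_) (m+n∸m≡n N i)
  ...   | no N+i≰2N = ⊥-elim (N+i≰2N (+-monoʳ-≤ N i≤N))
  positionCode-position (C , i) i<N with suc (N + N + i) <? N
  ... | yes p<N = ⊥-elim (<-asym p<N (s≤s (≤-trans (m≤m+n N N) (m≤m+n (N + N) i))))
  ... | no _ with suc (N + N + i) ≤? N + N
  ...   | yes p≤2N = ⊥-elim (<⇒≱ (s≤s (m≤m+n (N + N) i)) p≤2N)
  ...   | no _ = cong (C ,_) (m+n∸m≡n (N + N) i)

  position-bound : ∀ c → Valid c → position c ≤ N * 3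
  position-bound c vc = subst (position c ≤_) (sym (triple N)) (bound c vc)
    where
    bound : ∀ c → Valid c → position c ≤ N + N + N
    bound (A , i) i<N = ≤-trans (<⇒≤ i<N) (≤-trans (m≤m+n N N) (m≤m+n (N + N) N))
    bound (B , i) i≤N = ≤-trans (+-monoʳ-≤ N i≤N) (m≤m+n (N + N) N)
    bound (C , i) i<N = subst (_≤ N + N + N) (+-suc (N + N) i) (+-monoʳ-≤ (N + N) i<N)

  valid-positionCode : ∀ p → p ≤ N * 3 → Valid (positionCode p)
  valid-positionCode p p≤3N with p <? N
  ... | yes p<N = p<N
  ... | no p≮N with p ≤? N + N
  ...   | yes p≤2N = subst (p ∸ N ≤_) (m+n∸m≡n N N) (∸-monoˡ-≤ N p≤2N)
  ...   | no p≰2N = +-cancelˡ-≤ (N + N) _ N (begin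
          N + N + suc (p ∸ suc (N + N))   ≡⟨ cong (N + N +_) (sym (+-∸-assoc 1 (≰⇒> p≰2N))) ⟩
          N + N + (p ∸ (N + N))           ≡⟨ m+[n∸m]≡n (<⇒≤ (≰⇒> p≰2N)) ⟩
          p                               ≤⟨ p≤3N ⟩
          N * 3                           ≡⟨ triple N ⟩
          N + N + N                       ∎)
    where open ≤-Reasoning

  codeAt : Fin (suc (N * 3)) → Code
  codeAt p = positionCode (toℕ p)

  word : Word (suc N) (suc (N * 3))
  word p = fromℕ< (s≤s (letter-bound (codeAt p)))

  open Restrict {N * 3} (λ p → vertex (positionCode p)) (λ v → position (vertexCode v))
    (λ {p} p≤3N → vertex-bound _ (valid-positionCode p p≤3N))
    (λ {v} v≤3N → position-bound _ (valid-vertexCode v v≤3N))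
    (λ {v} v≤3N → trans (cong vertex (positionCode-position _ (valid-vertexCode v v≤3N))) (vertex-vertexCode v))
    (λ {p} _ → trans (cong position (vertexCode-vertex (positionCode p))) (position-positionCode p))

  valid-codeAt : ∀ p → Valid (codeAt p)
  valid-codeAt p = valid-positionCode _ (bounded p)

  toℕ-word : ∀ p → toℕ (word p) ≡ letter (codeAt p)
  toℕ-word p = toℕ-fromℕ< _

  toCodeArc : ∀ i j → ParikhArc word i j → CodeArc (codeAt i) (codeAt j)
  toCodeArc i j (i<j , e) =
    subst₂ _<_ (sym (position-positionCode (toℕ i))) (sym (position-positionCode (toℕ j))) i<j ,
    trans (sym (toℕ-word j)) (trans e (cong suc (toℕ-word i)))

  fromCodeArc : ∀ i j → CodeArc (codeAt i) (codeAt j) → ParikhArc word i j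
  fromCodeArc i j (i<j , e) =
    subst₂ _<_ (position-positionCode (toℕ i)) (position-positionCode (toℕ j)) i<j ,
    trans (toℕ-word j) (trans e (cong suc (sym (toℕ-word i))))

  open Inverse permutation using (to)

  next⇒successor : ∀ i j → codeAt j ≡ next (codeAt i) → toℕ (to j) ≡ suc (toℕ (to i))
  next⇒successor i j j-next = begin
    toℕ (to j)               ≡⟨ toℕ-permutation j ⟩
    vertex (codeAt j)        ≡⟨ cong vertex j-next ⟩
    vertex (next (codeAt i)) ≡⟨ vertex-next (codeAt i) ⟩
    suc (vertex (codeAt i))  ≡⟨ cong suc (sym (toℕ-permutation i)) ⟩
    suc (toℕ (to i))         ∎
    where open ≡-Reasoning

  successor⇒next : ∀ i j → toℕ (to j) ≡ suc (toℕ (to i)) → codeAt j ≡ next (codeAt i)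
  successor⇒next i j j-succ = vertex-injective (begin
    vertex (codeAt j)        ≡⟨ sym (toℕ-permutation j) ⟩
    toℕ (to j)               ≡⟨ j-succ ⟩
    suc (toℕ (to i))         ≡⟨ cong suc (toℕ-permutation i) ⟩
    suc (vertex (codeAt i))  ≡⟨ sym (vertex-next (codeAt i)) ⟩
    vertex (next (codeAt i)) ∎)
    where open ≡-Reasoning

  extremal : ParikhIsPath word (N * 3)
  extremal = iso-from-arcs word permutation arc⇒edge successor⇒arc
    where
    arc⇒edge : ∀ i j → ParikhArc word i j → PathAdj (N * 3) (to i) (to j)
    arc⇒edge i j i→j with arc⇒consecutive (codeAt i) (codeAt j) (valid-codeAt i) (valid-codeAt j) (toCodeArc i j i→j)
    ... | inj₁ j-next = inj₁ (next⇒successor i j j-next)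
    ... | inj₂ i-next = inj₂ (next⇒successor j i i-next)

    successor⇒arc : ∀ i j → toℕ (to j) ≡ suc (toℕ (to i)) → ParikhAdj word i j
    successor⇒arc i j j-succ =
      Sum.map (fromCodeArc i j) (fromCodeArc j i)
        (subst (λ d → CodeArc (codeAt i) d ⊎ CodeArc d (codeAt i)) (sym j-next)
          (consecutive⇒arc (codeAt i) (valid-codeAt i) (subst Valid j-next (valid-codeAt j))))
      where
      j-next : codeAt j ≡ next (codeAt i)
      j-next = successor⇒next i j j-succ

  existence : Σ ℕ λ n → Σ (Word (suc N) (suc n)) λ w → ParikhIsPath w (N * 3)
  existence = N * 3 , word , extremal

length-formula : ∀ N → 3 * suc N ∸ 3 ≡ N * 3
length-formula N = begin
  3 * suc N ∸ 3   ≡⟨ cong (_∸ 3) (*-suc 3 N) ⟩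
  3 + 3 * N ∸ 3   ≡⟨ m+n∸m≡n 3 (3 * N) ⟩
  3 * N           ≡⟨ *-comm 3 N ⟩
  N * 3           ∎
  where open ≡-Reasoning

theorem5p6 : (s : ℕ) → 2 ≤ s →
    (Σ ℕ (λ n → Σ (Word s (suc n)) (λ w → ParikhIsPath w (3 * s ∸ 3))))
    × ((n m : ℕ) (w : Word s (suc n)) → ParikhIsPath w m → m ≤ 3 * s ∸ 3)
-- With s = N + 1 (the hypothesis s ≥ 2 is only needed to have s ≥ 1) the
-- extremal word attains 3N and every Parikh path has length at most 3N.
theorem5p6 (suc N) (s≤s _) rewrite length-formula N =
  ExtremalWord.existence N , λ _ _ w iso → UpperBound.bound w iso
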